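{- Let $G$ be a group and let $X_0,X_1,\dots,X_m$ be transitive $G$-spaces linked by homogeneous $G$-equivariant maps $\pi_i:X_i\to X_{i+1}$, $i<m$. Let $K_i\subseteq X_i$, $i\le m$, be subsets such that for every $i<m$ either the restriction $\pi_i|_{K_i}:K_i\to K_{i+1}$ is bijective or $K_i=\pi_i^{ -1}(K_{i+1})$. If $K_m$ is a kaleidoscopical configuration in $X_m$, then for every $i\le m$ the set $K_i$ is a kaleidoscopical configuration in $X_i$.
   Context: A map $\varphi:X\to Y$ is homogeneous if there is a non-zero cardinal $\kappa$ with $|\varphi^{ -1}(y)|=\kappa$ for all $y\in Y$; it is $G$-equivariant if $\varphi(gx)=g\varphi(x)$. A subset $A$ of a $G$-space $Z$ is a kaleidoscopical configuration if there is a map $\chi:Z\to C$ to some set $C$ with $\chi|_{gA}:gA\to C$ bijective for every $g\in G$. -}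

module Defs where

open import Level using (Level; _⊔_; suc)
open import Algebra.Bundles using (Group)
open import Data.Product using (Σ; ∃; _×_; _,_)
open import Data.Fin using (Fin; inject₁) renaming (suc to fsuc)
open import Data.Nat using (ℕ) renaming (suc to nsuc)
open import Relation.Binary.PropositionalEquality using (_≡_)
open import Function.Bundles using (_↔_)
open import Data.Unit.Polymorphic using (⊤)

record GSpace {c ℓ : Level} (G : Group c ℓ) (o : Level) : Set (c ⊔ ℓ ⊔ Level.suc o) where
  open Group G
  field
    Carrier₀ : Set o
    act      : Carrier → Carrier₀ → Carrier₀
    act-cong : ∀ {g h} x → g ≈ h → act g x ≡ act h x
    act-id   : ∀ x → act ε x ≡ x
    act-comp : ∀ g h x → act (g ∙ h) x ≡ act g (act h x)

module _ {c ℓ o : Level} {G : Group c ℓ} where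
  open Group G using () renaming (Carrier to ∣G∣)
  open GSpace

  Transitive : GSpace G o → Set (c ⊔ o)
  Transitive X = ∀ (x y : Carrier₀ X) → ∃ λ (g : ∣G∣) → act X g x ≡ y

  Equivariant : (X Y : GSpace G o) → (Carrier₀ X → Carrier₀ Y) → Set (c ⊔ o)
  Equivariant X Y φ = ∀ (g : ∣G∣) x → φ (act X g x) ≡ act Y g (φ x)

Fibre : {o : Level} {A B : Set o} → (A → B) → B → Set o
Fibre {A = A} φ y = Σ A λ x → φ x ≡ y

-- homogeneous: all fibres have the same non-zero cardinality κ,
-- i.e. there is an inhabited type K in bijection with every fibre
Homogeneous : {o : Level} {A B : Set o} → (A → B) → Set (Level.suc o)
Homogeneous {o} {A} {B} φ = Σ (Set o) λ K → K × (∀ (y : B) → Fibre φ y ↔ K)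

Subset : {o : Level} → Set o → Set (Level.suc o)
Subset {o} A = A → Set o

BijectiveOn : {o : Level} {A B : Set o} → (A → B) → Subset A → Subset B → Set o
BijectiveOn {A = A} {B} φ S T =
  (∀ x → S x → T (φ x)) ×
  (∀ x x′ → S x → S x′ → φ x ≡ φ x′ → x ≡ x′) ×
  (∀ y → T y → Σ A λ x → S x × φ x ≡ y)

IsPreimage : {o : Level} {A B : Set o} → (A → B) → Subset A → Subset B → Set o
IsPreimage φ S T = (∀ x → S x → T (φ x)) × (∀ x → T (φ x) → S x)

module _ {c ℓ o : Level} {G : Group c ℓ} where
  open Group G using () renaming (Carrier to ∣G∣)
  open GSpace

  Translate : (Z : GSpace G o) → ∣G∣ → Subset (Carrier₀ Z) → Subset (Carrier₀ Z)
  Translate Z g A z = Σ (Carrier₀ Z) λ a → A a × z ≡ act Z g a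

  Kaleidoscopical : (Z : GSpace G o) → Subset (Carrier₀ Z) → Set (c ⊔ Level.suc o)
  Kaleidoscopical Z A =
    Σ (Set o) λ C → Σ (Carrier₀ Z → C) λ χ →
      ∀ (g : ∣G∣) → BijectiveOn χ (Translate Z g A) (λ _ → ⊤)

module Submission where

open import Defs
open import Level using (Level)
open import Algebra.Bundles using (Group)
open import Data.Nat using (ℕ; suc)
open import Data.Fin using (Fin; inject₁; fromℕ) renaming (suc to fsuc)
open import Data.Fin.Induction using (>-weakInduction)
open import Data.Sum using (_⊎_; inj₁; inj₂)
open import Data.Product using (_,_; _×_; proj₁; proj₂)
open import Data.Unit.Polymorphic using (⊤; tt)
open import Function using (_∘_)
open import Function.Bundles using (_↔_; Inverse; Injection)
open import Function.Properties.Inverse using (↔⇒↣)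
open import Relation.Binary.PropositionalEquality
  using (_≡_; refl; sym; trans; cong; cong₂; subst; module ≡-Reasoning)

-- Going down the tower one step at a time, a kaleidoscopical colouring χ of K₊ is pulled back
-- along π to K.  If π is a bijection K → K₊ then χ ∘ π works, because π also maps every
-- translate gK bijectively onto gK₊.  If K = π⁻¹(K₊) then gK = π⁻¹(gK₊), and homogeneity
-- identifies every fibre with one set κ; pairing χ ∘ π with this fibre coordinate gives a
-- colouring by C × κ.

module _ {o : Level} {A B C : Set o} where

  BijectiveOn-∘ : {f : A → B} {h : B → C} {S : Subset A} {T : Subset B} {U : Subset C} →
    BijectiveOn f S T → BijectiveOn h T U → BijectiveOn (h ∘ f) S U
  BijectiveOn-∘ {f} {h} (f-maps , f-inj , f-surj) (h-maps , h-inj , h-surj) =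
    (λ x Sx → h-maps (f x) (f-maps x Sx)) ,
    (λ x x′ Sx Sx′ e →
      f-inj x x′ Sx Sx′ (h-inj (f x) (f x′) (f-maps x Sx) (f-maps x′ Sx′) e)) ,
    λ z Uz → let (y , Ty , hy≡z) = h-surj z Uz
                 (x , Sx , fx≡y) = f-surj y Ty
             in x , Sx , trans (cong h fx≡y) hy≡z

module _ {o : Level} {A B : Set o} (π : A → B) {κ : Set o} (fibre↔ : ∀ y → Fibre π y ↔ κ) where

  fibreCoordinate : A → κ
  fibreCoordinate x = Inverse.to (fibre↔ (π x)) (x , refl)

  fibreCoordinate-transport : ∀ x {y} (πx≡y : π x ≡ y) →
    fibreCoordinate x ≡ Inverse.to (fibre↔ y) (x , πx≡y)
  fibreCoordinate-transport x refl = refl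

  fibreCoordinate-injective : ∀ {x x′} → π x ≡ π x′ →
    fibreCoordinate x ≡ fibreCoordinate x′ → x ≡ x′
  fibreCoordinate-injective {x} {x′} πx≡πx′ e =
    cong proj₁ (Injection.injective (↔⇒↣ (fibre↔ (π x))) (begin
      Inverse.to (fibre↔ (π x)) (x , refl)        ≡⟨ e ⟩
      fibreCoordinate x′                          ≡⟨ fibreCoordinate-transport x′ (sym πx≡πx′) ⟩
      Inverse.to (fibre↔ (π x)) (x′ , sym πx≡πx′) ∎))
    where open ≡-Reasoning

  preimage-pairing-bijective : {D : Set o} {χ : B → D} {S : Subset A} {T : Subset B} →
    IsPreimage π S T → BijectiveOn χ T (λ _ → ⊤) →
    BijectiveOn (λ x → χ (π x) , fibreCoordinate x) S (λ _ → ⊤)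
  preimage-pairing-bijective {χ = χ} {S} {T} (S⊆π⁻¹T , π⁻¹T⊆S) (_ , χ-inj , χ-surj) =
    (λ _ _ → tt) ,
    (λ x x′ Sx Sx′ e →
      fibreCoordinate-injective
        (χ-inj (π x) (π x′) (S⊆π⁻¹T x Sx) (S⊆π⁻¹T x′ Sx′) (cong proj₁ e))
        (cong proj₂ e)) ,
    λ { (d , k) _ →
      let (y , Ty , χy≡d) = χ-surj d tt
          (x , πx≡y) = Inverse.from (fibre↔ y) k
      in x , π⁻¹T⊆S x (subst T (sym πx≡y) Ty) ,
         cong₂ _,_ (trans (cong χ πx≡y) χy≡d)
                   (trans (fibreCoordinate-transport x πx≡y) (Inverse.strictlyInverseˡ (fibre↔ y) k)) }

module _ {c ℓ o : Level} {G : Group c ℓ} where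
  open Group G using (_⁻¹; inverseˡ; inverseʳ) renaming (Carrier to ∣G∣)

  module _ (Z : GSpace G o) where
    open GSpace Z

    act-inverseˡ : ∀ g x → act (g ⁻¹) (act g x) ≡ x
    act-inverseˡ g x = trans (sym (act-comp (g ⁻¹) g x)) (trans (act-cong x (inverseˡ g)) (act-id x))

    act-inverseʳ : ∀ g x → act g (act (g ⁻¹) x) ≡ x
    act-inverseʳ g x = trans (sym (act-comp g (g ⁻¹) x)) (trans (act-cong x (inverseʳ g)) (act-id x))

    act-injective : ∀ g {x y} → act g x ≡ act g y → x ≡ y
    act-injective g {x} {y} e = begin
      x                      ≡⟨ sym (act-inverseˡ g x) ⟩
      act (g ⁻¹) (act g x)   ≡⟨ cong (act (g ⁻¹)) e ⟩
      act (g ⁻¹) (act g y)   ≡⟨ act-inverseˡ g y ⟩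
      y                      ∎
      where open ≡-Reasoning

  module _ (X Y : GSpace G o) {π : GSpace.Carrier₀ X → GSpace.Carrier₀ Y}
           (π-equivariant : Equivariant X Y π) {S : Subset (GSpace.Carrier₀ X)}
           {T : Subset (GSpace.Carrier₀ Y)} where
    private
      module X = GSpace X
      module Y = GSpace Y

    BijectiveOn-translate : ∀ g → BijectiveOn π S T →
      BijectiveOn π (Translate X g S) (Translate Y g T)
    BijectiveOn-translate g (maps , inj , surj) =
      (λ { _ (a , Sa , refl) → π a , maps a Sa , π-equivariant g a }) ,
      (λ { _ _ (a , Sa , refl) (a′ , Sa′ , refl) e → cong (X.act g) (inj a a′ Sa Sa′
             (act-injective Y g (trans (sym (π-equivariant g a)) (trans e (π-equivariant g a′))))) }) ,
      λ { _ (b , Tb , refl) → let (a , Sa , πa≡b) = surj b Tb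
            in X.act g a , (a , Sa , refl) , trans (π-equivariant g a) (cong (Y.act g) πa≡b) }

    IsPreimage-translate : ∀ g → IsPreimage π S T →
      IsPreimage π (Translate X g S) (Translate Y g T)
    IsPreimage-translate g (S⊆π⁻¹T , π⁻¹T⊆S) =
      (λ { _ (a , Sa , refl) → π a , S⊆π⁻¹T a Sa , π-equivariant g a }) ,
      λ z (b , Tb , πz≡gb) →
        let a = X.act (g ⁻¹) z
            πa≡b = begin
              π (X.act (g ⁻¹) z)       ≡⟨ π-equivariant (g ⁻¹) z ⟩
              Y.act (g ⁻¹) (π z)       ≡⟨ cong (Y.act (g ⁻¹)) πz≡gb ⟩
              Y.act (g ⁻¹) (Y.act g b) ≡⟨ act-inverseˡ Y g b ⟩
              b                        ∎
        in a , π⁻¹T⊆S a (subst T (sym πa≡b) Tb) , sym (act-inverseʳ X g z)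
      where open ≡-Reasoning

    Kaleidoscopical-bijective-pullback : BijectiveOn π S T → Kaleidoscopical Y T → Kaleidoscopical X S
    Kaleidoscopical-bijective-pullback π-bij (C , χ , χ-bij) =
      C , χ ∘ π , λ g → BijectiveOn-∘ (BijectiveOn-translate g π-bij) (χ-bij g)

    Kaleidoscopical-preimage-pullback : Homogeneous π → IsPreimage π S T →
      Kaleidoscopical Y T → Kaleidoscopical X S
    Kaleidoscopical-preimage-pullback (κ , _ , fibre↔) S≡π⁻¹T (C , χ , χ-bij) =
      (C × κ) , (λ x → χ (π x) , fibreCoordinate π fibre↔ x) ,
      λ g → preimage-pairing-bijective π fibre↔ (IsPreimage-translate g S≡π⁻¹T) (χ-bij g)

proposition2p2 : {c ℓ o : Level} (G : Group c ℓ) (m : ℕ)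
    (X : Fin (suc m) → GSpace G o)
    → (∀ i → Transitive (X i))
    → (π : (i : Fin m) → GSpace.Carrier₀ (X (inject₁ i)) → GSpace.Carrier₀ (X (fsuc i)))
    → (∀ i → Homogeneous (π i))
    → (∀ i → Equivariant (X (inject₁ i)) (X (fsuc i)) (π i))
    → (K : (i : Fin (suc m)) → Subset (GSpace.Carrier₀ (X i)))
    → (∀ (i : Fin m) → BijectiveOn (π i) (K (inject₁ i)) (K (fsuc i))
    ⊎ IsPreimage (π i) (K (inject₁ i)) (K (fsuc i)))
    → Kaleidoscopical (X (fromℕ m)) (K (fromℕ m))
    → ∀ (i : Fin (suc m)) → Kaleidoscopical (X i) (K i)
proposition2p2 G m X _ π homogeneous equivariant K bijective-or-preimage top =
  >-weakInduction (λ i → Kaleidoscopical (X i) (K i)) top pullback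
  where
  pullback : ∀ i → Kaleidoscopical (X (fsuc i)) (K (fsuc i)) →
                   Kaleidoscopical (X (inject₁ i)) (K (inject₁ i))
  pullback i with bijective-or-preimage i
  ... | inj₁ bijective =
    Kaleidoscopical-bijective-pullback (X (inject₁ i)) (X (fsuc i)) (equivariant i) bijective
  ... | inj₂ preimage  =
    Kaleidoscopical-preimage-pullback (X (inject₁ i)) (X (fsuc i)) (equivariant i) (homogeneous i) preimage
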